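{- Let $\mathcal N$ be a phylogenetic network on $X$, let $A\subseteq X$, and let $v$ be a reticulation of $\mathcal N$. If a parent of $v$ is a vertex of $\mathcal N_A$, then $v$ is a vertex of $\mathcal N_A$.
   Context: All paths are directed. A (binary) phylogenetic network $\mathcal N$ on a non-empty finite set $X$ is a rooted acyclic directed graph with no parallel arcs such that: the unique root has in-degree 0 and out-degree 2; the set of vertices of out-degree 0 is $X$ (the leaves), each of in-degree 1; every other vertex has either in-degree 1 and out-degree 2 (tree vertex) or in-degree 2 and out-degree 1 (reticulation). If $|X|=1$, $\mathcal N$ may also be the single vertex of $X$. A stable ancestor of $X'\subseteq X$ is a vertex $u$ such that for every $x\in X'$ every path from the root to $x$ traverses $u$; ${\rm lsa}(X')$ is the unique stable ancestor of $X'$ with no other stable ancestor of $X'$ as a descendant. The path graph of $\mathcal N$ on $A$ is the subgraph consisting of all vertices and arcs on paths from ${\rm lsa}(A)$ to leaves in $A$. The full simplification of a directed graph is obtained by repeatedly suppressing vertices of in-degree one and out-degree one and deleting exactly one arc of any pair of parallel arcs until neither applies; $\mathcal N_A$ (the network exhibited by $\mathcal N$ on $A$) is the full simplification of the path graph, so its vertices form a subset of the vertices of $\mathcal N$. -}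

module Defs where

open import Level using (0ℓ)
open import Data.Nat using (ℕ)
open import Data.Fin using (Fin)
open import Data.Fin.Properties using () renaming (_≟_ to _≟ᶠ_)
open import Data.Product using (Σ; _×_; _,_; proj₁; proj₂; ∃-syntax)
open import Data.Sum using (_⊎_)
open import Data.List using (List; []; _∷_; _++_; length; filter)
open import Data.List.Membership.Propositional using (_∈_)
open import Data.List.Relation.Unary.Unique.Propositional using (Unique)
open import Relation.Nullary using (¬_)
open import Relation.Nullary.Decidable using (¬?; _×-dec_)
open import Relation.Binary.PropositionalEquality using (_≡_; _≢_)
open import Function.Bundles using (_⇔_)

Arc : ℕ → Set
Arc n = Fin n × Fin n

module _ {n : ℕ} where

  indeg : List (Arc n) → Fin n → ℕ
  indeg as v = length (filter (λ a → proj₂ a ≟ᶠ v) as)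

  outdeg : List (Arc n) → Fin n → ℕ
  outdeg as v = length (filter (λ a → proj₁ a ≟ᶠ v) as)

  data Path (as : List (Arc n)) : Fin n → Fin n → Set where
    []  : ∀ {v} → Path as v v
    _∷_ : ∀ {u w x} → (u , w) ∈ as → Path as w x → Path as u x

  OnPath : ∀ {as u x} → Path as u x → Fin n → Set
  OnPath {u = u} []      z = z ≡ u
  OnPath {u = u} (_ ∷ p) z = z ≡ u ⊎ OnPath p z

record Network (n : ℕ) : Set where
  field
    arcs      : List (Arc n)
    noParallel : Unique arcs
    root      : Fin n
    acyclic   : ∀ {u w} → (u , w) ∈ arcs → ¬ Path arcs w u
    degrees   :
      ((∀ v → v ≡ root) × arcs ≡ [])
      ⊎
      ((indeg arcs root ≡ 0 × outdeg arcs root ≡ 2) ×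
       (∀ v → v ≢ root →
          (indeg arcs v ≡ 1 × outdeg arcs v ≡ 0) ⊎
          (indeg arcs v ≡ 1 × outdeg arcs v ≡ 2) ⊎
          (indeg arcs v ≡ 2 × outdeg arcs v ≡ 1)))

module _ {n : ℕ} (N : Network n) where
  open Network N

  -- leaves: the vertices of out-degree 0 (the set X)
  IsLeaf : Fin n → Set
  IsLeaf v = outdeg arcs v ≡ 0

  IsReticulation : Fin n → Set
  IsReticulation v = indeg arcs v ≡ 2 × outdeg arcs v ≡ 1

  StableAncestor : (Fin n → Set) → Fin n → Set
  StableAncestor A u = ∀ x → A x → (p : Path arcs root x) → OnPath p u

  IsLSA : (Fin n → Set) → Fin n → Set
  IsLSA A u = StableAncestor A u ×
              (∀ w → StableAncestor A w → w ≢ u → ¬ Path arcs u w)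

record Graph (n : ℕ) : Set where
  constructor graph
  field
    verts : List (Fin n)
    garcs : List (Arc n)
open Graph public

module _ {n : ℕ} (N : Network n) (A : Fin n → Set) (l : Fin n) where
  open Network N

  OnLsaPath : Fin n → Set
  OnLsaPath w = Path arcs l w × ∃[ a ] (A a × Path arcs w a)

  IsPathGraph : Graph n → Set
  IsPathGraph G =
    Unique (verts G) × Unique (garcs G) ×
    (∀ w → (w ∈ verts G) ⇔ OnLsaPath w) ×
    (∀ u w → ((u , w) ∈ garcs G) ⇔
       ((u , w) ∈ arcs × Path arcs l u × ∃[ a ] (A a × Path arcs w a)))

module _ {n : ℕ} where

  data Step : Graph n → Graph n → Set where
    suppress : ∀ {G} w u x →
      w ∈ verts G → indeg (garcs G) w ≡ 1 → outdeg (garcs G) w ≡ 1 →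
      (u , w) ∈ garcs G → (w , x) ∈ garcs G →
      Step G (graph (filter (λ z → ¬? (z ≟ᶠ w)) (verts G))
                    ((u , x) ∷ filter (λ a → ¬? (proj₁ a ≟ᶠ w) ×-dec ¬? (proj₂ a ≟ᶠ w)) (garcs G)))
    -- delete exactly one arc of a pair of parallel arcs
    deleteParallel : ∀ {G} l₁ a l₂ → garcs G ≡ l₁ ++ a ∷ l₂ → a ∈ l₁ ++ l₂ →
      Step G (graph (verts G) (l₁ ++ l₂))

  data Steps : Graph n → Graph n → Set where
    done : ∀ {G} → Steps G G
    step : ∀ {G H K} → Step G H → Steps H K → Steps G K

  FullSimplification : Graph n → Graph n → Set
  FullSimplification G H = Steps G H × (∀ K → ¬ Step H K)

module Submission where

-- Follow the full simplification from the path graph G to H with an invariant: every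
-- vertex of the current graph K lies in G, the arcs of K are exactly the gaps between its
-- vertices (paths of N with at least one arc whose inner vertices avoid K), and every
-- vertex of G deleted so far has a unique gap-predecessor and gap-successor in K.
--
-- Suppose p ∈ H but v ∉ H. Then all gaps from p to H end at one vertex x: if v does not
-- reach A, every such gap leaves p through its other child; otherwise the second parent q
-- of v is not in H, the last vertex of H above q is p, and so both children of p lead to
-- the successor of v in H. Thus p has out-degree one in H. If p = lsa(A), x would be a
-- lower stable ancestor of A; otherwise p, a tree vertex of N, also has in-degree one in H
-- and could still be suppressed, although H is fully simplified.


open import Defs
open import Data.Fin using (Fin)
open import Data.Product using (_,_)
open import Data.List.Membership.Propositional using (_∈_)

open import Data.Nat using (ℕ; zero; suc; _≤_; _<_; z≤n; s≤s)
open import Data.Nat.Properties using (≤-refl; ≤⇒≯; <-irrefl; suc-injective)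
open import Data.Fin.Properties using () renaming (_≟_ to _≟ᶠ_)
open import Data.Product using (Σ; _×_; proj₁; proj₂; ∃-syntax)
open import Data.Sum using (_⊎_; inj₁; inj₂)
open import Data.Empty using (⊥; ⊥-elim)
open import Data.List using (List; []; _∷_; _++_; length; filter; allFin)
open import Data.List.Properties using (length-removeAt′; filter-none)
open import Data.List.Relation.Unary.Any using (here; there; index)
open import Data.List.Relation.Unary.AllPairs using (_∷_)
open import Data.List.Relation.Unary.All using ([]; _∷_; tabulate)
open import Data.List.Membership.Propositional using (_∉_; _─_)
open import Data.List.Membership.Propositional.Properties
  using (∈-filter⁺; ∈-filter⁻; ∈-++⁺ˡ; ∈-++⁺ʳ; ∈-++⁻; ∈-allFin; ∈-length; ∉[])
open import Data.List.Relation.Unary.Unique.Propositional using (Unique)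
open import Data.List.Relation.Unary.Unique.Propositional.Properties using (filter⁺)
open import Relation.Nullary using (¬_; yes; no)
open import Relation.Nullary.Decidable using (¬?; _×-dec_)
open import Relation.Unary using (Decidable)
open import Relation.Binary.PropositionalEquality
  using (_≡_; _≢_; refl; sym; trans; cong; cong₂; subst)
open import Function.Base using (_∘_)
open import Function.Bundles using (_⇔_; Equivalence)

module _ {B : Set} where

  ∈-─ : ∀ {x y : B} {ys} (x∈ys : x ∈ ys) → y ∈ ys → y ≢ x → y ∈ ys ─ x∈ys
  ∈-─ (here refl)  (here refl)  y≢x = ⊥-elim (y≢x refl)
  ∈-─ (here refl)  (there y∈ys) _   = y∈ys
  ∈-─ (there _)    (here refl)  _   = here refl
  ∈-─ (there x∈ys) (there y∈ys) y≢x = there (∈-─ x∈ys y∈ys y≢x)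

  distinct⇒1<length : ∀ {x y : B} {ys} → x ∈ ys → y ∈ ys → y ≢ x → 1 < length ys
  distinct⇒1<length {ys = ys} x∈ys y∈ys y≢x
    rewrite length-removeAt′ ys (index x∈ys) =
    s≤s (∈-length (∈-─ x∈ys y∈ys y≢x))

  distinct⇒2<length : ∀ {x y z : B} {ys} → x ∈ ys → y ∈ ys → z ∈ ys →
                      y ≢ x → z ≢ x → z ≢ y → 2 < length ys
  distinct⇒2<length {ys = ys} x∈ys y∈ys z∈ys y≢x z≢x z≢y
    rewrite length-removeAt′ ys (index x∈ys) =
    s≤s (distinct⇒1<length (∈-─ x∈ys y∈ys y≢x) (∈-─ x∈ys z∈ys z≢x) z≢y)

  length≡1⇒∈-unique : ∀ {x y : B} {ys} → length ys ≡ 1 → x ∈ ys → y ∈ ys → x ≡ y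
  length≡1⇒∈-unique {ys = _ ∷ []} _ (here refl) (here refl) = refl

  0<length⇒∃∈ : ∀ (ys : List B) → 0 < length ys → ∃[ x ] x ∈ ys
  0<length⇒∃∈ (y ∷ _) _ = y , here refl

  -- The absence of a parallel pair, phrased as in 'deleteParallel'.
  NoRepeats : List B → Set
  NoRepeats xs = ∀ l₁ a l₂ → xs ≡ l₁ ++ a ∷ l₂ → a ∉ l₁ ++ l₂

  length-filter≡1 : ∀ {P : B → Set} (P? : Decidable P) {xs} c → NoRepeats xs →
                    c ∈ xs → P c → (∀ e → e ∈ xs → P e → e ≡ c) → length (filter P? xs) ≡ 1
  length-filter≡1 {P = P} P? {y ∷ ys} c noRep c∈xs Pc onlyC with P? y
  ... | yes Py = cong (suc ∘ length) (filter-none P? (tabulate ¬P))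
    where
      ¬P : ∀ {e} → e ∈ ys → ¬ P e
      ¬P e∈ys Pe = noRep [] y ys refl
        (subst (_∈ ys) (trans (onlyC _ (there e∈ys) Pe) (sym (onlyC y (here refl) Py))) e∈ys)
  ... | no ¬Py with c∈xs
  ...   | here refl = ⊥-elim (¬Py Pc)
  ...   | there c∈ys = length-filter≡1 P? c
          (λ l₁ a l₂ eq a∈ → noRep (y ∷ l₁) a l₂ (cong (y ∷_) eq) (there a∈))
          c∈ys Pc (λ e e∈ys → onlyC e (there e∈ys))

module _ {n : ℕ} {as : List (Arc n)} where

  ∈⇒0<outdeg : ∀ {u w} → (u , w) ∈ as → 0 < outdeg as u
  ∈⇒0<outdeg e = ∈-length (∈-filter⁺ (λ a → proj₁ a ≟ᶠ _) e refl)

  ∈⇒0<indeg : ∀ {u w} → (u , w) ∈ as → 0 < indeg as w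
  ∈⇒0<indeg e = ∈-length (∈-filter⁺ (λ a → proj₂ a ≟ᶠ _) e refl)

  indeg≡1⇒tail-unique : ∀ {u u′ w} → indeg as w ≡ 1 → (u , w) ∈ as → (u′ , w) ∈ as → u ≡ u′
  indeg≡1⇒tail-unique {w = w} deg e e′ = cong proj₁
    (length≡1⇒∈-unique deg (∈-filter⁺ (λ a → proj₂ a ≟ᶠ w) e refl) (∈-filter⁺ (λ a → proj₂ a ≟ᶠ w) e′ refl))

  outdeg≡1⇒head-unique : ∀ {u w w′} → outdeg as u ≡ 1 → (u , w) ∈ as → (u , w′) ∈ as → w ≡ w′
  outdeg≡1⇒head-unique {u} deg e e′ = cong proj₂
    (length≡1⇒∈-unique deg (∈-filter⁺ (λ a → proj₁ a ≟ᶠ u) e refl) (∈-filter⁺ (λ a → proj₁ a ≟ᶠ u) e′ refl))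

  infixr 5 _++ₚ_
  _++ₚ_ : ∀ {a b c} → Path as a b → Path as b c → Path as a c
  []      ++ₚ q = q
  (e ∷ p) ++ₚ q = e ∷ (p ++ₚ q)

  OnPath-++⁻ : ∀ {a b c z} (p : Path as a b) (q : Path as b c) → OnPath (p ++ₚ q) z → OnPath p z ⊎ OnPath q z
  OnPath-++⁻ []      q z∈q         = inj₂ z∈q
  OnPath-++⁻ (e ∷ p) q (inj₁ z≡a)  = inj₁ (inj₁ z≡a)
  OnPath-++⁻ (e ∷ p) q (inj₂ z∈pq) with OnPath-++⁻ p q z∈pq
  ... | inj₁ z∈p = inj₁ (inj₂ z∈p)
  ... | inj₂ z∈q = inj₂ z∈q

  prefixTo : ∀ {a b z} (p : Path as a b) → OnPath p z → Path as a z
  prefixTo []      refl        = []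
  prefixTo (e ∷ p) (inj₁ refl) = []
  prefixTo (e ∷ p) (inj₂ z∈p)  = e ∷ prefixTo p z∈p

  suffixFrom : ∀ {a b z} (p : Path as a b) → OnPath p z →
               Σ (Path as z b) (λ q → ∀ y → OnPath q y → OnPath p y)
  suffixFrom []      refl        = [] , λ _ y∈q → y∈q
  suffixFrom (e ∷ p) (inj₁ refl) = e ∷ p , λ _ y∈q → y∈q
  suffixFrom (e ∷ p) (inj₂ z∈p) with suffixFrom p z∈p
  ... | q , q⊆p = q , λ y y∈q → inj₂ (q⊆p y y∈q)

module NetworkProperties {n : ℕ} (N : Network n) where
  open Network N

  outdeg≤2 : ∀ u → outdeg arcs u ≤ 2
  outdeg≤2 u with degrees
  ... | inj₁ (_ , arcs≡[]) rewrite arcs≡[] = z≤n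
  ... | inj₂ ((_ , root-out) , classify) with u ≟ᶠ root
  ...   | yes refl rewrite root-out = ≤-refl
  ...   | no u≢root with classify u u≢root
  ...     | inj₁ (_ , out) rewrite out = z≤n
  ...     | inj₂ (inj₁ (_ , out)) rewrite out = ≤-refl
  ...     | inj₂ (inj₂ (_ , out)) rewrite out = s≤s z≤n

  child-of-two : ∀ {p v c z} → (p , v) ∈ arcs → (p , c) ∈ arcs → c ≢ v → (p , z) ∈ arcs → z ≡ v ⊎ z ≡ c
  child-of-two {p} {v} {c} {z} pv pc c≢v pz with z ≟ᶠ v | z ≟ᶠ c
  ... | yes z≡v | _       = inj₁ z≡v
  ... | no _    | yes z≡c = inj₂ z≡c
  ... | no z≢v  | no z≢c  = ⊥-elim (≤⇒≯ (outdeg≤2 p)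
        (distinct⇒2<length (out pv) (out pc) (out pz) (c≢v ∘ cong proj₂) (z≢v ∘ cong proj₂) (z≢c ∘ cong proj₂)))
    where
      out : ∀ {w} → (p , w) ∈ arcs → (p , w) ∈ filter (λ a → proj₁ a ≟ᶠ p) arcs
      out e = ∈-filter⁺ (λ a → proj₁ a ≟ᶠ p) e refl

  nonroot⇒0<indeg : ∀ {y} → y ≢ root → 0 < indeg arcs y
  nonroot⇒0<indeg {y} y≢root with degrees
  ... | inj₁ (all-root , _) = ⊥-elim (y≢root (all-root y))
  ... | inj₂ (_ , classify) with classify y y≢root
  ...   | inj₁ (deg , _)        rewrite deg = s≤s z≤n
  ...   | inj₂ (inj₁ (deg , _)) rewrite deg = s≤s z≤n
  ...   | inj₂ (inj₂ (deg , _)) rewrite deg = s≤s z≤n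

  parent-of-nonroot : ∀ {y} → y ≢ root → ∃[ y′ ] (y′ , y) ∈ arcs
  parent-of-nonroot {y} y≢root with 0<length⇒∃∈ (filter (λ a → proj₂ a ≟ᶠ y) arcs) (nonroot⇒0<indeg y≢root)
  ... | (y′ , _) , m with ∈-filter⁻ (λ a → proj₂ a ≟ᶠ y) m
  ...   | e , refl = y′ , e

  -- Climbing to parents must reach the root: S lists all ancestors of y, and by
  -- acyclicity y is no ancestor of its parent, so S shrinks at each step.
  path-from-root : ∀ y → Path arcs root y
  path-from-root y = climb _ (allFin n) refl y (λ z _ → ∈-allFin z)
    where
      climb : ∀ k S → length S ≡ k → ∀ y → (∀ z → Path arcs z y → z ∈ S) → Path arcs root y
      climb zero S |S|≡0 y ancestors = ⊥-elim (<-irrefl refl (subst (0 <_) |S|≡0 (∈-length (ancestors y []))))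
      climb (suc k) S |S|≡k+1 y ancestors with y ≟ᶠ root
      ... | yes refl = []
      ... | no y≢root with parent-of-nonroot y≢root
      ...   | y′ , e = climb k (S ─ y∈S) |S─y|≡k y′ ancestors′ ++ₚ (e ∷ [])
        where
          y∈S : y ∈ S
          y∈S = ancestors y []
          |S─y|≡k : length (S ─ y∈S) ≡ k
          |S─y|≡k = suc-injective (trans (sym (length-removeAt′ S (index y∈S))) |S|≡k+1)
          ancestors′ : ∀ z → Path arcs z y′ → z ∈ S ─ y∈S
          ancestors′ z π = ∈-─ y∈S (ancestors z (π ++ₚ (e ∷ [])))
                             (λ { refl → acyclic e π })

  second-parent : ∀ {p v} → IsReticulation N v → ∃[ q ] ((q , v) ∈ arcs × q ≢ p)
  second-parent {p} {v} (deg , _) =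
    other (filter (λ a → proj₂ a ≟ᶠ v) arcs) (filter⁺ (λ a → proj₂ a ≟ᶠ v) noParallel) deg
          (∈-filter⁻ (λ a → proj₂ a ≟ᶠ v))
    where
      other : ∀ es → Unique es → length es ≡ 2 → (∀ {e} → e ∈ es → e ∈ arcs × proj₂ e ≡ v) →
              ∃[ q ] ((q , v) ∈ arcs × q ≢ p)
      other ((q₁ , _) ∷ (q₂ , _) ∷ []) ((distinct ∷ []) ∷ _) _ into
        with into (here refl) | into (there (here refl))
      ... | e₁ , refl | e₂ , refl with q₁ ≟ᶠ p | q₂ ≟ᶠ p
      ...   | no q₁≢p  | _        = q₁ , e₁ , q₁≢p
      ...   | yes _    | no q₂≢p  = q₂ , e₂ , q₂≢p
      ...   | yes refl | yes refl = ⊥-elim (distinct refl)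

  branching⇒indeg≡1 : ∀ {r p v c} → (r , p) ∈ arcs → (p , v) ∈ arcs → (p , c) ∈ arcs → c ≢ v →
                      indeg arcs p ≡ 1
  branching⇒indeg≡1 {p = p} rp pv pc c≢v with degrees
  ... | inj₁ (_ , arcs≡[]) = ⊥-elim (∉[] (subst (_ ∈_) arcs≡[] pv))
  ... | inj₂ ((root-in , _) , classify) with p ≟ᶠ root
  ...   | yes refl = ⊥-elim (<-irrefl refl (subst (0 <_) root-in (∈⇒0<indeg rp)))
  ...   | no p≢root with classify p p≢root
  ...     | inj₁ (_ , out)        = ⊥-elim (<-irrefl refl (subst (0 <_) out (∈⇒0<outdeg pv)))
  ...     | inj₂ (inj₁ (deg , _)) = deg
  ...     | inj₂ (inj₂ (_ , out)) = ⊥-elim (<-irrefl refl (subst (1 <_) out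
            (distinct⇒1<length (out′ pv) (out′ pc) (c≢v ∘ cong proj₂))))
    where
      out′ : ∀ {w} → (p , w) ∈ arcs → (p , w) ∈ filter (λ a → proj₁ a ≟ᶠ p) arcs
      out′ e = ∈-filter⁺ (λ a → proj₁ a ≟ᶠ p) e refl

module Gaps {n : ℕ} (N : Network n) where
  open Network N
  open import Data.List.Membership.DecPropositional (_≟ᶠ_ {n}) using (_∈?_) public

  data Gap (vs : List (Fin n)) : Fin n → Fin n → Set where
    arc     : ∀ {y z} → (y , z) ∈ arcs → Gap vs y z
    through : ∀ {y t z} → (y , t) ∈ arcs → t ∉ vs → Gap vs t z → Gap vs y z

  -- What remains of a gap after its first arc.
  data GapTail (vs : List (Fin n)) : Fin n → Fin n → Set where
    arrived : ∀ {z} → GapTail vs z z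
    outside : ∀ {t z} → t ∉ vs → Gap vs t z → GapTail vs t z

  module _ {vs : List (Fin n)} where

    gap⇒path : ∀ {y z} → Gap vs y z → Path arcs y z
    gap⇒path (arc e)         = e ∷ []
    gap⇒path (through e _ g) = e ∷ gap⇒path g

    gap-acyclic : ∀ {y z} → Gap vs y z → ¬ Path arcs z y
    gap-acyclic (arc e)         π = acyclic e π
    gap-acyclic (through e _ g) π = acyclic e (gap⇒path g ++ₚ π)

    gap-irreflexive : ∀ {y} → ¬ Gap vs y y
    gap-irreflexive g = gap-acyclic g []

    gap-++ : ∀ {y t z} → Gap vs y t → t ∉ vs → Gap vs t z → Gap vs y z
    gap-++ (arc e)              t∉vs g = through e t∉vs g
    gap-++ (through e s∉vs g₁) t∉vs g = through e s∉vs (gap-++ g₁ t∉vs g)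

    gap-snoc : ∀ {y t z} → Gap vs y t → t ∉ vs → (t , z) ∈ arcs → Gap vs y z
    gap-snoc g t∉vs e = gap-++ g t∉vs (arc e)

    gap-head : ∀ {y z} → Gap vs y z → ∃[ t ] ((y , t) ∈ arcs × GapTail vs t z)
    gap-head (arc e)            = _ , e , arrived
    gap-head (through e t∉vs g) = _ , e , outside t∉vs g

    arc+tail⇒gap : ∀ {y t z} → (y , t) ∈ arcs → GapTail vs t z → Gap vs y z
    arc+tail⇒gap e arrived          = arc e
    arc+tail⇒gap e (outside t∉vs g) = through e t∉vs g

    gap-last-arc : ∀ {y z} → Gap vs y z →
                   (y , z) ∈ arcs ⊎ ∃[ r ] ((r , z) ∈ arcs × r ∉ vs × Gap vs y r)
    gap-last-arc (arc e) = inj₁ e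
    gap-last-arc (through e t∉vs g) with gap-last-arc g
    ... | inj₁ e′                   = inj₂ (_ , e′ , t∉vs , arc e)
    ... | inj₂ (r , e′ , r∉vs , g′) = inj₂ (r , e′ , r∉vs , through e t∉vs g′)

    gap-snoc-head : ∀ {y t z} → Gap vs y t → t ∉ vs → (t , z) ∈ arcs →
                    ∃[ s ] ((y , s) ∈ arcs × s ∉ vs × Gap vs s z)
    gap-snoc-head (arc e)            t∉vs e′ = _ , e , t∉vs , arc e′
    gap-snoc-head (through e s∉vs g) t∉vs e′ = _ , e , s∉vs , gap-snoc g t∉vs e′

    first-member : ∀ {t a} (π : Path arcs t a) → a ∈ vs →
                   ∃[ z ] (z ∈ vs × GapTail vs t z × OnPath π z)
    first-member []            a∈vs = _ , a∈vs , arrived , refl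
    first-member {t} (e ∷ π) a∈vs with t ∈? vs
    ... | yes t∈vs = t , t∈vs , arrived , inj₁ refl
    ... | no t∉vs with first-member π a∈vs
    ...   | z , z∈vs , tail , z∈π = z , z∈vs , outside t∉vs (arc+tail⇒gap e tail) , inj₂ z∈π

    last-member-or-gap : ∀ {s t z} → (s , t) ∈ arcs → Path arcs t z →
                         ∃[ y ] (y ∈ vs × Gap vs y z) ⊎ Gap vs s z
    last-member-or-gap e [] = inj₂ (arc e)
    last-member-or-gap {t = t} e (e′ ∷ π) with last-member-or-gap e′ π
    ... | inj₁ found = inj₁ found
    ... | inj₂ g with t ∈? vs
    ...   | yes t∈vs = inj₁ (t , t∈vs , g)
    ...   | no t∉vs  = inj₂ (through e t∉vs g)

    last-member : ∀ {s z} → s ∈ vs → Path arcs s z → s ≢ z → ∃[ y ] (y ∈ vs × Gap vs y z)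
    last-member s∈vs []      s≢z = ⊥-elim (s≢z refl)
    last-member s∈vs (e ∷ π) _   with last-member-or-gap e π
    ... | inj₁ found = found
    ... | inj₂ g     = _ , s∈vs , g

  gap-mono : ∀ {vs ws y z} → (∀ {t} → t ∈ ws → t ∈ vs) → Gap vs y z → Gap ws y z
  gap-mono ws⊆vs (arc e)            = arc e
  gap-mono ws⊆vs (through e t∉vs g) = through e (t∉vs ∘ ws⊆vs) (gap-mono ws⊆vs g)

module PathGraphSimplification {n : ℕ} (N : Network n) (A : Fin n → Set)
  (A⊆leaves : ∀ x → A x → IsLeaf N x) (l : Fin n)
  (G : Graph n) (G-path-graph : IsPathGraph N A l G) where
  open Network N
  open NetworkProperties N
  open Gaps N

  ReachesA : Fin n → Set
  ReachesA z = ∃[ a ] (A a × Path arcs z a)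

  ∈G⇒OnLsaPath : ∀ {y} → y ∈ verts G → Path arcs l y × ReachesA y
  ∈G⇒OnLsaPath = Equivalence.to (proj₁ (proj₂ (proj₂ G-path-graph)) _)

  OnLsaPath⇒∈G : ∀ {y} → Path arcs l y → ReachesA y → y ∈ verts G
  OnLsaPath⇒∈G π r = Equivalence.from (proj₁ (proj₂ (proj₂ G-path-graph)) _) (π , r)

  arc∈G⇔ : ∀ {u w} → ((u , w) ∈ garcs G) ⇔ ((u , w) ∈ arcs × Path arcs l u × ReachesA w)
  arc∈G⇔ = proj₂ (proj₂ (proj₂ G-path-graph)) _ _

  ReachesA-backwards : ∀ {y z} → Path arcs y z → ReachesA z → ReachesA y
  ReachesA-backwards π (a , Aa , σ) = a , Aa , (π ++ₚ σ)

  between-G : ∀ {y z} → y ∈ verts G → Path arcs y z → ReachesA z → z ∈ verts G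
  between-G y∈G π r = OnLsaPath⇒∈G (proj₁ (∈G⇒OnLsaPath y∈G) ++ₚ π) r

  A-no-out-arc : ∀ {a t} → A a → (a , t) ∉ arcs
  A-no-out-arc {a} Aa e = <-irrefl refl (subst (0 <_) (A⊆leaves a Aa) (∈⇒0<outdeg e))

  record Invariant (K : Graph n) : Set where
    field
      verts⊆G        : ∀ {y} → y ∈ verts K → y ∈ verts G
      arc⇒gap        : ∀ {y z} → (y , z) ∈ garcs K → y ∈ verts K × z ∈ verts K × Gap (verts K) y z
      gap⇒arc        : ∀ {y z} → y ∈ verts K → z ∈ verts K → Gap (verts K) y z → (y , z) ∈ garcs K
      in-gap-unique  : ∀ {w y₁ y₂} → w ∈ verts G → w ∉ verts K → y₁ ∈ verts K → y₂ ∈ verts K →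
                       Gap (verts K) y₁ w → Gap (verts K) y₂ w → y₁ ≡ y₂
      out-gap-unique : ∀ {w z₁ z₂} → w ∈ verts G → w ∉ verts K → z₁ ∈ verts K → z₂ ∈ verts K →
                       Gap (verts K) w z₁ → Gap (verts K) w z₂ → z₁ ≡ z₂
      A-kept         : ∀ {a} → A a → a ∈ verts G → a ∈ verts K
      lsa-kept       : l ∈ verts G → l ∈ verts K
  open Invariant

  invariant-G : Invariant G
  invariant-G = record
    { verts⊆G        = λ y∈G → y∈G
    ; arc⇒gap        = arc⇒gap-G
    ; gap⇒arc        = gap⇒arc-G
    ; in-gap-unique  = λ w∈G w∉G → ⊥-elim (w∉G w∈G)
    ; out-gap-unique = λ w∈G w∉G → ⊥-elim (w∉G w∈G)
    ; A-kept         = λ _ a∈G → a∈G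
    ; lsa-kept       = λ l∈G → l∈G
    }
    where
      arc⇒gap-G : ∀ {y z} → (y , z) ∈ garcs G → y ∈ verts G × z ∈ verts G × Gap (verts G) y z
      arc⇒gap-G yz∈G with Equivalence.to arc∈G⇔ yz∈G
      ... | e , l⇝y , r = OnLsaPath⇒∈G l⇝y (ReachesA-backwards (e ∷ []) r)
                        , OnLsaPath⇒∈G (l⇝y ++ₚ (e ∷ [])) r , arc e

      -- Every vertex of N between two vertices of G is in G, so gaps of G are single arcs.
      gap⇒arc-G : ∀ {y z} → y ∈ verts G → z ∈ verts G → Gap (verts G) y z → (y , z) ∈ garcs G
      gap⇒arc-G y∈G z∈G (arc e) =
        Equivalence.from arc∈G⇔ (e , proj₁ (∈G⇒OnLsaPath y∈G) , proj₂ (∈G⇒OnLsaPath z∈G))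
      gap⇒arc-G y∈G z∈G (through e t∉G g) =
        ⊥-elim (t∉G (between-G y∈G (e ∷ []) (ReachesA-backwards (gap⇒path g) (proj₂ (∈G⇒OnLsaPath z∈G)))))

  module Suppression (K : Graph n) (I : Invariant K) (w u x : Fin n) (w∈K : w ∈ verts K)
    (w-in : indeg (garcs K) w ≡ 1) (w-out : outdeg (garcs K) w ≡ 1)
    (uw : (u , w) ∈ garcs K) (wx : (w , x) ∈ garcs K) where

    vs vs′ : List (Fin n)
    vs  = verts K
    vs′ = filter (λ z → ¬? (z ≟ᶠ w)) vs

    as′ : List (Arc n)
    as′ = (u , x) ∷ filter (λ a → ¬? (proj₁ a ≟ᶠ w) ×-dec ¬? (proj₂ a ≟ᶠ w)) (garcs K)

    ∈vs′ : ∀ {y} → y ∈ vs → y ≢ w → y ∈ vs′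
    ∈vs′ y∈vs y≢w = ∈-filter⁺ (λ z → ¬? (z ≟ᶠ w)) y∈vs y≢w

    ∈vs′⁻ : ∀ {y} → y ∈ vs′ → y ∈ vs × y ≢ w
    ∈vs′⁻ = ∈-filter⁻ (λ z → ¬? (z ≟ᶠ w))

    vs′⊆vs : ∀ {y} → y ∈ vs′ → y ∈ vs
    vs′⊆vs = proj₁ ∘ ∈vs′⁻

    w∉vs′ : w ∉ vs′
    w∉vs′ w∈vs′ = proj₂ (∈vs′⁻ w∈vs′) refl

    into-w : ∀ {y} → y ∈ vs → Gap vs y w → y ≡ u
    into-w y∈vs g = indeg≡1⇒tail-unique w-in (gap⇒arc I y∈vs w∈K g) uw

    out-of-w : ∀ {z} → z ∈ vs → Gap vs w z → z ≡ x
    out-of-w z∈vs g = outdeg≡1⇒head-unique w-out (gap⇒arc I w∈K z∈vs g) wx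

    gap-uw : Gap vs u w
    gap-uw = proj₂ (proj₂ (arc⇒gap I uw))

    gap-wx : Gap vs w x
    gap-wx = proj₂ (proj₂ (arc⇒gap I wx))

    gap-split : ∀ {y z} → Gap vs′ y z → Gap vs y z ⊎ (Gap vs y w × Gap vs′ w z)
    gap-split (arc e) = inj₁ (arc e)
    gap-split (through {t = t} e t∉vs′ g) with t ≟ᶠ w
    ... | yes refl = inj₂ (arc e , g)
    ... | no t≢w with gap-split g
    ...   | inj₁ g′        = inj₁ (through e (t∉vs′ ∘ (λ t∈vs → ∈vs′ t∈vs t≢w)) g′)
    ...   | inj₂ (g₁ , g₂) = inj₂ (through e (t∉vs′ ∘ (λ t∈vs → ∈vs′ t∈vs t≢w)) g₁ , g₂)

    -- A gap of vs′ passes through w at most once, since gaps of vs never return to w.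
    gap-split-at-w : ∀ {y z} → Gap vs′ y z → Gap vs y z ⊎ (Gap vs y w × Gap vs w z)
    gap-split-at-w g with gap-split g
    ... | inj₁ g′ = inj₁ g′
    ... | inj₂ (g₁ , g₂) with gap-split g₂
    ...   | inj₁ g₂′      = inj₂ (g₁ , g₂′)
    ...   | inj₂ (g-ww , _) = ⊥-elim (gap-irreflexive g-ww)

    arc⇒gap′ : ∀ {y z} → (y , z) ∈ as′ → y ∈ vs′ × z ∈ vs′ × Gap vs′ y z
    arc⇒gap′ (here refl) =
      ∈vs′ u∈vs (λ { refl → gap-irreflexive gap-uw }) , ∈vs′ x∈vs (λ { refl → gap-irreflexive gap-wx }) ,
      gap-++ (gap-mono vs′⊆vs gap-uw) w∉vs′ (gap-mono vs′⊆vs gap-wx)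
      where
        u∈vs = proj₁ (arc⇒gap I uw)
        x∈vs = proj₁ (proj₂ (arc⇒gap I wx))
    arc⇒gap′ (there yz∈) with ∈-filter⁻ (λ a → ¬? (proj₁ a ≟ᶠ w) ×-dec ¬? (proj₂ a ≟ᶠ w)) yz∈
    ... | yz∈K , (y≢w , z≢w) with arc⇒gap I yz∈K
    ...   | y∈vs , z∈vs , g = ∈vs′ y∈vs y≢w , ∈vs′ z∈vs z≢w , gap-mono vs′⊆vs g

    gap⇒arc′ : ∀ {y z} → y ∈ vs′ → z ∈ vs′ → Gap vs′ y z → (y , z) ∈ as′
    gap⇒arc′ y∈vs′ z∈vs′ g with ∈vs′⁻ y∈vs′ | ∈vs′⁻ z∈vs′ | gap-split-at-w g
    ... | y∈vs , y≢w | z∈vs , z≢w | inj₁ g′ =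
      there (∈-filter⁺ (λ a → ¬? (proj₁ a ≟ᶠ w) ×-dec ¬? (proj₂ a ≟ᶠ w)) (gap⇒arc I y∈vs z∈vs g′) (y≢w , z≢w))
    ... | y∈vs , _ | z∈vs , _ | inj₂ (g₁ , g₂) = here (cong₂ _,_ (into-w y∈vs g₁) (out-of-w z∈vs g₂))

    entering : ∀ {y w′} → y ∈ vs′ → Gap vs′ y w′ → Gap vs y w′ ⊎ (y ≡ u × Gap vs w w′)
    entering y∈vs′ g with gap-split-at-w g
    ... | inj₁ g′       = inj₁ g′
    ... | inj₂ (g₁ , g₂) = inj₂ (into-w (vs′⊆vs y∈vs′) g₁ , g₂)

    leaving : ∀ {z w′} → z ∈ vs′ → Gap vs′ w′ z → Gap vs w′ z ⊎ (z ≡ x × Gap vs w′ w)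
    leaving z∈vs′ g with gap-split-at-w g
    ... | inj₁ g′       = inj₁ g′
    ... | inj₂ (g₁ , g₂) = inj₂ (out-of-w (vs′⊆vs z∈vs′) g₂ , g₁)

    into-w′ : ∀ {y} → y ∈ vs′ → Gap vs′ y w → y ≡ u
    into-w′ y∈vs′ g with entering y∈vs′ g
    ... | inj₁ g′         = into-w (vs′⊆vs y∈vs′) g′
    ... | inj₂ (_ , g-ww) = ⊥-elim (gap-irreflexive g-ww)

    out-of-w′ : ∀ {z} → z ∈ vs′ → Gap vs′ w z → z ≡ x
    out-of-w′ z∈vs′ g with leaving z∈vs′ g
    ... | inj₁ g′         = out-of-w (vs′⊆vs z∈vs′) g′
    ... | inj₂ (_ , g-ww) = ⊥-elim (gap-irreflexive g-ww)

    in-gap-unique′ : ∀ {w′ y₁ y₂} → w′ ∈ verts G → w′ ∉ vs′ → y₁ ∈ vs′ → y₂ ∈ vs′ →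
                     Gap vs′ y₁ w′ → Gap vs′ y₂ w′ → y₁ ≡ y₂
    in-gap-unique′ {w′} w′∈G w′∉vs′ y₁∈vs′ y₂∈vs′ g₁ g₂ with w′ ≟ᶠ w
    ... | yes refl = trans (into-w′ y₁∈vs′ g₁) (sym (into-w′ y₂∈vs′ g₂))
    ... | no w′≢w  = compare y₁∈vs′ y₂∈vs′ (entering y₁∈vs′ g₁) (entering y₂∈vs′ g₂)
      where
        unique : ∀ {y₁ y₂} → y₁ ∈ vs → y₂ ∈ vs → Gap vs y₁ w′ → Gap vs y₂ w′ → y₁ ≡ y₂
        unique = in-gap-unique I w′∈G (λ w′∈vs → w′∉vs′ (∈vs′ w′∈vs w′≢w))
        compare : ∀ {y₁ y₂} → y₁ ∈ vs′ → y₂ ∈ vs′ →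
                  Gap vs y₁ w′ ⊎ (y₁ ≡ u × Gap vs w w′) → Gap vs y₂ w′ ⊎ (y₂ ≡ u × Gap vs w w′) → y₁ ≡ y₂
        compare y₁∈ y₂∈ (inj₁ h₁)         (inj₁ h₂)         = unique (vs′⊆vs y₁∈) (vs′⊆vs y₂∈) h₁ h₂
        compare _   _   (inj₂ (y₁≡u , _)) (inj₂ (y₂≡u , _)) = trans y₁≡u (sym y₂≡u)
        compare y₁∈ _   (inj₁ h₁)         (inj₂ (_ , h₂))   = ⊥-elim (proj₂ (∈vs′⁻ y₁∈) (unique (vs′⊆vs y₁∈) w∈K h₁ h₂))
        compare _   y₂∈ (inj₂ (_ , h₁))   (inj₁ h₂)         = ⊥-elim (proj₂ (∈vs′⁻ y₂∈) (unique (vs′⊆vs y₂∈) w∈K h₂ h₁))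

    out-gap-unique′ : ∀ {w′ z₁ z₂} → w′ ∈ verts G → w′ ∉ vs′ → z₁ ∈ vs′ → z₂ ∈ vs′ →
                      Gap vs′ w′ z₁ → Gap vs′ w′ z₂ → z₁ ≡ z₂
    out-gap-unique′ {w′} w′∈G w′∉vs′ z₁∈vs′ z₂∈vs′ g₁ g₂ with w′ ≟ᶠ w
    ... | yes refl = trans (out-of-w′ z₁∈vs′ g₁) (sym (out-of-w′ z₂∈vs′ g₂))
    ... | no w′≢w  = compare z₁∈vs′ z₂∈vs′ (leaving z₁∈vs′ g₁) (leaving z₂∈vs′ g₂)
      where
        unique : ∀ {z₁ z₂} → z₁ ∈ vs → z₂ ∈ vs → Gap vs w′ z₁ → Gap vs w′ z₂ → z₁ ≡ z₂
        unique = out-gap-unique I w′∈G (λ w′∈vs → w′∉vs′ (∈vs′ w′∈vs w′≢w))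
        compare : ∀ {z₁ z₂} → z₁ ∈ vs′ → z₂ ∈ vs′ →
                  Gap vs w′ z₁ ⊎ (z₁ ≡ x × Gap vs w′ w) → Gap vs w′ z₂ ⊎ (z₂ ≡ x × Gap vs w′ w) → z₁ ≡ z₂
        compare z₁∈ z₂∈ (inj₁ h₁)         (inj₁ h₂)         = unique (vs′⊆vs z₁∈) (vs′⊆vs z₂∈) h₁ h₂
        compare _   _   (inj₂ (z₁≡x , _)) (inj₂ (z₂≡x , _)) = trans z₁≡x (sym z₂≡x)
        compare z₁∈ _   (inj₁ h₁)         (inj₂ (_ , h₂))   = ⊥-elim (proj₂ (∈vs′⁻ z₁∈) (unique (vs′⊆vs z₁∈) w∈K h₁ h₂))
        compare _   z₂∈ (inj₂ (_ , h₁))   (inj₁ h₂)         = ⊥-elim (proj₂ (∈vs′⁻ z₂∈) (unique (vs′⊆vs z₂∈) w∈K h₂ h₁))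

    -- w has an out-arc, so it is no leaf; and w has a gap from u, which lies below l.
    invariant′ : Invariant (graph vs′ as′)
    invariant′ = record
      { verts⊆G        = verts⊆G I ∘ vs′⊆vs
      ; arc⇒gap        = arc⇒gap′
      ; gap⇒arc        = gap⇒arc′
      ; in-gap-unique  = in-gap-unique′
      ; out-gap-unique = out-gap-unique′
      ; A-kept         = λ Aa a∈G → ∈vs′ (A-kept I Aa a∈G) (λ { refl → A-no-out-arc Aa (proj₁ (proj₂ (gap-head gap-wx))) })
      ; lsa-kept       = λ l∈G → ∈vs′ (lsa-kept I l∈G) (λ { refl →
                           gap-acyclic gap-uw (proj₁ (∈G⇒OnLsaPath (verts⊆G I (proj₁ (arc⇒gap I uw))))) })
      }

  preserved-by-step : ∀ {K K′} → Invariant K → Step K K′ → Invariant K′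
  preserved-by-step {K} I (suppress w u x w∈K w-in w-out uw wx) =
    Suppression.invariant′ K I w u x w∈K w-in w-out uw wx
  preserved-by-step {K} I (deleteParallel l₁ a l₂ split a∈rest) = record
    { verts⊆G        = verts⊆G I
    ; arc⇒gap        = arc⇒gap I ∘ ⊆K
    ; gap⇒arc        = λ y∈K z∈K g → K⊆ (gap⇒arc I y∈K z∈K g)
    ; in-gap-unique  = in-gap-unique I
    ; out-gap-unique = out-gap-unique I
    ; A-kept         = A-kept I
    ; lsa-kept       = lsa-kept I
    }
    where
      ⊆K : ∀ {e} → e ∈ l₁ ++ l₂ → e ∈ garcs K
      ⊆K e∈ with ∈-++⁻ l₁ e∈
      ... | inj₁ e∈l₁ = subst (_ ∈_) (sym split) (∈-++⁺ˡ e∈l₁)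
      ... | inj₂ e∈l₂ = subst (_ ∈_) (sym split) (∈-++⁺ʳ l₁ (there e∈l₂))
      K⊆ : ∀ {e} → e ∈ garcs K → e ∈ l₁ ++ l₂
      K⊆ e∈K with ∈-++⁻ l₁ (subst (_ ∈_) split e∈K)
      ... | inj₁ e∈l₁         = ∈-++⁺ˡ e∈l₁
      ... | inj₂ (here refl)  = a∈rest
      ... | inj₂ (there e∈l₂) = ∈-++⁺ʳ l₁ e∈l₂

  preserved-by-steps : ∀ {K K′} → Steps K K′ → Invariant K → Invariant K′
  preserved-by-steps done         I = I
  preserved-by-steps (step s ss) I = preserved-by-steps ss (preserved-by-step I s)

  module Irreducible (lsa : IsLSA N A l) (H : Graph n) (IH : Invariant H) (irreducible : ∀ K → ¬ Step H K)
    {v p : Fin n} (v-ret : IsReticulation N v) (pv : (p , v) ∈ arcs)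
    (p∈H : p ∈ verts H) (v∉H : v ∉ verts H) where

    vs : List (Fin n)
    vs = verts H

    p∈G : p ∈ verts G
    p∈G = verts⊆G IH p∈H

    l⇝p : Path arcs l p
    l⇝p = proj₁ (∈G⇒OnLsaPath p∈G)

    p-reaches-A : ReachesA p
    p-reaches-A = proj₂ (∈G⇒OnLsaPath p∈G)

    l∈H : l ∈ vs
    l∈H = lsa-kept IH (OnLsaPath⇒∈G [] (ReachesA-backwards l⇝p p-reaches-A))

    A-in-H : ∀ {a} → A a → Path arcs l a → a ∈ vs
    A-in-H Aa l⇝a = A-kept IH Aa (OnLsaPath⇒∈G l⇝a (_ , Aa , []))

    tail-reaches-A : ∀ {z t} → GapTail vs z t → t ∈ vs → ReachesA z
    tail-reaches-A arrived       t∈H = proj₂ (∈G⇒OnLsaPath (verts⊆G IH t∈H))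
    tail-reaches-A (outside _ g) t∈H = ReachesA-backwards (gap⇒path g) (tail-reaches-A arrived t∈H)

    tail-unique : ∀ {c z₁ z₂} → c ∈ verts G → GapTail vs c z₁ → GapTail vs c z₂ → z₁ ∈ vs → z₂ ∈ vs → z₁ ≡ z₂
    tail-unique c∈G arrived           arrived          _    _    = refl
    tail-unique c∈G arrived           (outside c∉H _)  z₁∈H _    = ⊥-elim (c∉H z₁∈H)
    tail-unique c∈G (outside c∉H _)   arrived          _    z₂∈H = ⊥-elim (c∉H z₂∈H)
    tail-unique c∈G (outside c∉H g₁) (outside _ g₂)   z₁∈H z₂∈H = out-gap-unique IH c∈G c∉H z₁∈H z₂∈H g₁ g₂

    -- p is a tree vertex whose gaps to H all end at the same vertex, i.e. its out-degree in H is one.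
    record Funnel : Set where
      field
        exit               : Fin n
        exit∈H             : exit ∈ vs
        gap-to-exit        : Gap vs p exit
        gap-to-exit-unique : ∀ {t} → Gap vs p t → t ∈ vs → t ≡ exit
        sibling            : Fin n
        p→sibling          : (p , sibling) ∈ arcs
        sibling≢v          : sibling ≢ v

    funnel : ∀ {c x} → (p , c) ∈ arcs → c ≢ v → c ∈ verts G → GapTail vs c x → x ∈ vs →
             (∀ {t} → GapTail vs v t → t ∈ vs → t ≡ x) → Funnel
    funnel {c} {x} pc c≢v c∈G c⇝x x∈H via-v = record
      { exit = x ; exit∈H = x∈H ; gap-to-exit = arc+tail⇒gap pc c⇝x ; gap-to-exit-unique = unique
      ; sibling = c ; p→sibling = pc ; sibling≢v = c≢v }
      where
        unique : ∀ {t} → Gap vs p t → t ∈ vs → t ≡ x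
        unique g t∈H with gap-head g
        ... | z , pz , z⇝t with child-of-two pv pc c≢v pz
        ...   | inj₁ refl = via-v z⇝t t∈H
        ...   | inj₂ refl = tail-unique c∈G z⇝t c⇝x t∈H x∈H

    funnel-if-v-not-reaching : ¬ ReachesA v → Funnel
    funnel-if-v-not-reaching v-stuck with p-reaches-A
    ... | a , Aa , []       = ⊥-elim (A-no-out-arc Aa pv)
    ... | a , Aa , (pc ∷ σ) with first-member σ (A-in-H Aa (l⇝p ++ₚ pc ∷ σ))
    ...   | x , x∈H , c⇝x , _ =
            funnel pc (λ { refl → v-stuck (a , Aa , σ) }) (between-G p∈G (pc ∷ []) (a , Aa , σ)) c⇝x x∈H
                   (λ v⇝t t∈H → ⊥-elim (v-stuck (tail-reaches-A v⇝t t∈H)))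

    -- l is on every root path through q and v to a, but not below v (else l⇝p⇝v⇝l is a cycle).
    lsa⇝second-parent : ∀ {q a} → (q , v) ∈ arcs → A a → Path arcs v a → Path arcs l q
    lsa⇝second-parent {q} qv Aa v⇝a with OnPath-++⁻ (path-from-root q) (qv ∷ v⇝a)
                                          (proj₁ lsa _ Aa (path-from-root q ++ₚ qv ∷ v⇝a))
    ... | inj₁ l-above-q        = proj₁ (suffixFrom (path-from-root q) l-above-q)
    ... | inj₂ (inj₁ refl)      = []
    ... | inj₂ (inj₂ l-below-v) = ⊥-elim (acyclic pv (prefixTo v⇝a l-below-v ++ₚ l⇝p))

    -- Gaps into v ∉ H start at p only, and the last vertex of H above q has one into v via q.
    gap-to-second-parent : ∀ {q a} → (q , v) ∈ arcs → q ≢ p → A a → Path arcs v a → q ∉ vs × Gap vs p q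
    gap-to-second-parent {q} qv q≢p Aa v⇝a = q∉H , gap-pq
      where
        v∈G : v ∈ verts G
        v∈G = between-G p∈G (pv ∷ []) (_ , Aa , v⇝a)
        q∉H : q ∉ vs
        q∉H q∈H = q≢p (in-gap-unique IH v∈G v∉H q∈H p∈H (arc qv) (arc pv))
        gap-pq : Gap vs p q
        gap-pq with last-member l∈H (lsa⇝second-parent qv Aa v⇝a) (λ { refl → q∉H l∈H })
        ... | y , y∈H , gap-yq with in-gap-unique IH v∈G v∉H y∈H p∈H (gap-snoc gap-yq q∉H qv) (arc pv)
        ...   | refl = gap-yq

    funnel-if-v-reaching : ReachesA v → Funnel
    funnel-if-v-reaching (a , Aa , v⇝a)
      with first-member v⇝a (A-in-H Aa (l⇝p ++ₚ pv ∷ v⇝a)) | second-parent {p} v-ret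
    ... | x , x∈H , arrived , _       | _ = ⊥-elim (v∉H x∈H)
    ... | x , x∈H , outside _ v→x , _ | q , qv , q≢p with gap-to-second-parent qv q≢p Aa v⇝a
    ...   | q∉H , gap-pq with gap-snoc-head gap-pq q∉H qv
    ...     | s , ps , s∉H , gap-sv =
              funnel ps (λ { refl → gap-irreflexive gap-sv })
                (between-G p∈G (ps ∷ []) (ReachesA-backwards (gap⇒path gap-sv) (a , Aa , v⇝a)))
                (outside s∉H (gap-++ gap-sv v∉H v→x)) x∈H
                (λ v⇝t t∈H → tail-unique (between-G p∈G (pv ∷ []) (a , Aa , v⇝a)) v⇝t (outside v∉H v→x) t∈H x∈H)

    no-repeats : NoRepeats (garcs H)
    no-repeats l₁ a l₂ split a∈rest = irreducible _ (deleteParallel l₁ a l₂ split a∈rest)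

    -- p is a tree vertex of N, so its unique N-parent r determines the last arc of every gap into p.
    in-gap-unique-p : ∀ {s y} → indeg arcs p ≡ 1 → s ∈ vs → y ∈ vs → Gap vs s p → Gap vs y p → s ≡ y
    in-gap-unique-p p-in s∈H y∈H g₁ g₂ with gap-last-arc g₁ | gap-last-arc g₂
    ... | inj₁ sp | inj₁ yp = indeg≡1⇒tail-unique p-in sp yp
    ... | inj₁ sp | inj₂ (r , rp′ , r∉H , _) = ⊥-elim (r∉H (subst (_∈ vs) (indeg≡1⇒tail-unique p-in sp rp′) s∈H))
    ... | inj₂ (r , rp′ , r∉H , _) | inj₁ yp = ⊥-elim (r∉H (subst (_∈ vs) (indeg≡1⇒tail-unique p-in yp rp′) y∈H))
    ... | inj₂ (r , rp₁ , r∉H , g₁′) | inj₂ (r′ , rp₂ , _ , g₂′) with indeg≡1⇒tail-unique p-in rp₁ rp₂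
    ...   | refl = in-gap-unique IH r∈G r∉H s∈H y∈H g₁′ g₂′
      where
        r∈G : r ∈ verts G
        r∈G = between-G (verts⊆G IH y∈H) (gap⇒path g₂′) (ReachesA-backwards (rp₂ ∷ []) p-reaches-A)

    module _ (F : Funnel) where
      open Funnel F

      outdeg-p≡1 : outdeg (garcs H) p ≡ 1
      outdeg-p≡1 = length-filter≡1 (λ a → proj₁ a ≟ᶠ p) (p , exit) no-repeats
                     (gap⇒arc IH p∈H exit∈H gap-to-exit) refl only-exit
        where
          only-exit : ∀ e → e ∈ garcs H → proj₁ e ≡ p → e ≡ (p , exit)
          only-exit (_ , t) pt∈H refl with arc⇒gap IH pt∈H
          ... | _ , t∈H , g = cong (p ,_) (gap-to-exit-unique g t∈H)

      indeg-p≡1 : ∀ {y} → y ∈ vs → Gap vs y p → indeg (garcs H) p ≡ 1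
      indeg-p≡1 {y} y∈H gap-yp = length-filter≡1 (λ a → proj₂ a ≟ᶠ p) (y , p) no-repeats
                                   (gap⇒arc IH y∈H p∈H gap-yp) refl only-y
        where
          rp : ∃[ r ] (r , p) ∈ arcs
          rp with gap-last-arc gap-yp
          ... | inj₁ e           = y , e
          ... | inj₂ (r , e , _) = r , e
          only-y : ∀ e → e ∈ garcs H → proj₂ e ≡ p → e ≡ (y , p)
          only-y (s , _) sp∈H refl with arc⇒gap IH sp∈H
          ... | s∈H , _ , g = cong (_, p) (in-gap-unique-p
                (branching⇒indeg≡1 (proj₂ rp) pv p→sibling sibling≢v) s∈H y∈H g gap-yp)

      -- If l = p, every path from l to A passes the exit, which thus is a lower stable ancestor.
      lsa≢p : l ≢ p
      lsa≢p refl = proj₂ lsa exit exit-stable (λ { refl → gap-irreflexive gap-to-exit }) (gap⇒path gap-to-exit)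
        where
          on-exit : ∀ {a} → A a → (σ : Path arcs p a) → OnPath σ exit
          on-exit Aa []      = ⊥-elim (A-no-out-arc Aa pv)
          on-exit Aa (e ∷ σ) with first-member σ (A-in-H Aa (e ∷ σ))
          ... | y , y∈H , tail , y∈σ with gap-to-exit-unique (arc+tail⇒gap e tail) y∈H
          ...   | refl = inj₂ y∈σ
          exit-stable : StableAncestor N A exit
          exit-stable a Aa π with suffixFrom π (proj₁ lsa a Aa π)
          ... | σ , σ⊆π = σ⊆π exit (on-exit Aa σ)

      funnel-impossible : ⊥
      funnel-impossible with last-member l∈H l⇝p lsa≢p
      ... | y , y∈H , gap-yp = irreducible _ (suppress p y exit p∈H (indeg-p≡1 y∈H gap-yp) outdeg-p≡1
                                  (gap⇒arc IH y∈H p∈H gap-yp) (gap⇒arc IH p∈H exit∈H gap-to-exit))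

    -- Constructively, ReachesA v need not be decided: its negation already yields a funnel.
    absurd : ⊥
    absurd = funnel-impossible (funnel-if-v-not-reaching (funnel-impossible ∘ funnel-if-v-reaching))

lemma2p4 : ∀ {n} (N : Network n) (A : Fin n → Set) →
    (∀ x → A x → IsLeaf N x) →
    ∀ l → IsLSA N A l →
    ∀ G → IsPathGraph N A l G →
    ∀ H → FullSimplification G H →
    ∀ v p → IsReticulation N v → (p , v) ∈ Network.arcs N →
    p ∈ verts H → v ∈ verts H
lemma2p4 N A A⊆leaves l lsa G G-path-graph H (simplifies , irreducible) v p v-ret pv p∈H
  with Gaps._∈?_ N v (verts H)
... | yes v∈H = v∈H
... | no v∉H  = ⊥-elim (Irreducible.absurd lsa H (preserved-by-steps simplifies invariant-G) irreducible v-ret pv p∈H v∉H)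
  where open PathGraphSimplification N A A⊆leaves l G G-path-graph
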